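{- There exist a finite set $\Sigma$, a family $\mathcal{F}\subseteq P(\Sigma)$ of "closed" subsets of $\Sigma$ that contains $\emptyset$, $\Sigma$ and every singleton and is closed under arbitrary intersections, and a union-preserving map $f:P(\Sigma)\to P(\Sigma)$ such that: (i) $f$ satisfies the continuity condition $\mathrm{cl}(A)=\mathrm{cl}(B)\Rightarrow \mathrm{cl}(f(A))=\mathrm{cl}(f(B))$ for all $A,B\subseteq\Sigma$; but (ii) the map $g:P(\Sigma)\to P(\Sigma)$, $g(A)=\{p\in\Sigma\mid \exists q\in A:\ q\in f(\{p\})\}$, induced by the inverse of the relation $R_f=\{(p,q)\in\Sigma\times\Sigma\mid q\in f(\{p\})\}$, does not satisfy this continuity condition.
   Context: For a family $\mathcal{F}$ of subsets of $\Sigma$ closed under arbitrary intersections and containing $\Sigma$, the closure of $A\subseteq\Sigma$ is $\mathrm{cl}(A)=\bigcap\{C\in\mathcal{F}\mid A\subseteq C\}$; the closed sets ordered by inclusion form a complete lattice (a complete atomistic lattice whose atoms are the singletons when all singletons are closed), and $\mathrm{cl}(A)$ is the join of the atoms $\{p\}$, $p\in A$. A map $f:P(\Sigma)\to P(\Sigma)$ is union-preserving if $f(\bigcup_i A_i)=\bigcup_i f(A_i)$ for every family $(A_i)$; such a map corresponds bijectively to the relation $R_f$ on $\Sigma$. -}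

module Defs where

open import Level using (0ℓ)
open import Data.Nat using (ℕ)
open import Data.Fin using (Fin)
open import Data.Fin.Subset using (Subset; _∈_; _⊆_; _∩_; ⁅_⁆; ⊥; ⊤; Nonempty)
open import Data.Fin.Subset.Properties using (nonempty?)
open import Data.Vec using (tabulate)
open import Data.Product using (Σ; ∃; _×_)
open import Function.Bundles using (_⇔_)
open import Relation.Nullary using (does; ¬_)

Family : ℕ → Set₁
Family n = Subset n → Set

IsIntersection : ∀ {n} {I : Set} → (I → Subset n) → Subset n → Set
IsIntersection {n} {I} A C = ∀ (p : Fin n) → (p ∈ C) ⇔ (∀ (i : I) → p ∈ A i)

IsUnion : ∀ {n} {I : Set} → (I → Subset n) → Subset n → Set
IsUnion {n} {I} A C = ∀ (p : Fin n) → (p ∈ C) ⇔ ∃ (λ (i : I) → p ∈ A i)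

ClosedUnderIntersections : ∀ {n} → Family n → Set₁
ClosedUnderIntersections {n} F =
  ∀ (I : Set) (A : I → Subset n) (C : Subset n) →
    (∀ i → F (A i)) → IsIntersection A C → F C

IsClosureFamily : ∀ {n} → Family n → Set₁
IsClosureFamily {n} F =
  F ⊥ × F ⊤ × (∀ (p : Fin n) → F ⁅ p ⁆) × ClosedUnderIntersections F

_∈cl[_]_ : ∀ {n} → Fin n → Family n → Subset n → Set
_∈cl[_]_ {n} p F A = ∀ (C : Subset n) → F C → A ⊆ C → p ∈ C

SameClosure : ∀ {n} → Family n → Subset n → Subset n → Set
SameClosure {n} F A B = ∀ (p : Fin n) → (p ∈cl[ F ] A) ⇔ (p ∈cl[ F ] B)

UnionPreserving : ∀ {n} → (Subset n → Subset n) → Set₁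
UnionPreserving {n} f =
  ∀ (I : Set) (A : I → Subset n) (C : Subset n) →
    IsUnion A C → IsUnion (λ i → f (A i)) (f C)

Continuous : ∀ {n} → Family n → (Subset n → Subset n) → Set
Continuous {n} F f =
  ∀ (A B : Subset n) → SameClosure F A B → SameClosure F (f A) (f B)

inverseMap : ∀ {n} → (Subset n → Subset n) → Subset n → Subset n
inverseMap f A = tabulate (λ p → does (nonempty? (A ∩ f ⁅ p ⁆)))

-- Take Σ = {0,1,2}, with closed sets those X satisfying the implication {1,2} ⊆ X ⇒ 0 ∈ X,
-- and let f A = {0} if A meets {1,2}, f A = ∅ otherwise, i.e. R_f = {(1,0),(2,0)}.
-- Taking closures only ever adds the point 0, which f ignores, so f is continuous.
-- The inverse relation gives g A = {1,2} if 0 ∈ A and ∅ otherwise. Now {1,2} and Σ have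
-- the same closure Σ, but g {1,2} = ∅ is closed while g Σ = {1,2} has closure Σ.
module Submission where

open import Defs
open import Data.Bool using (Bool; T)
open import Data.Bool.Properties using (T-≡)
open import Data.Empty using (⊥-elim)
open import Data.Fin using (Fin; zero; suc)
open import Data.Fin.Subset
  using (Subset; _∈_; _⊆_; _∩_; _∪_; ⁅_⁆; ⊥; ⊤; Nonempty; outside; inside)
open import Data.Fin.Subset.Properties
  using (⊆-antisym; _⊆?_; nonempty?; x∈p∩q⁺; x∈p∩q⁻; x∈p∪q⁺; x∈p∪q⁻; x∈⁅x⁆; x∈⁅y⁆⇒x≡y; ∉⊥; ∈⊤)
open import Data.Nat using (ℕ)
open import Data.Product using (Σ; ∃; _×_; _,_)
open import Data.Sum using (_⊎_; inj₁; inj₂)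
open import Data.Vec using (_∷_; []; tabulate)
open import Data.Vec.Properties using (lookup∘tabulate; lookup⇒[]=; []=⇒lookup)
open import Function using (id)
open import Function.Bundles using (_⇔_; mk⇔; Equivalence)
open import Relation.Binary.PropositionalEquality using (_≡_; refl; sym; trans; cong; subst)
open import Relation.Nullary using (¬_; Dec; yes; no; does)

open Equivalence

record IsClosureOperatorOf {n} (F : Family n) (c : Subset n → Subset n) : Set where
  field
    closed    : ∀ A → F (c A)
    extensive : ∀ A → A ⊆ c A
    least     : ∀ {A C} → F C → A ⊆ C → c A ⊆ C

module ClosureOperator {n} {F : Family n} {c : Subset n → Subset n}
                       (isClosure : IsClosureOperatorOf F c) where

  open IsClosureOperatorOf isClosure

  fixed⇒closed : ∀ {A} → c A ≡ A → F A
  fixed⇒closed {A} cA≡A = subst F cA≡A (closed A)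

  ∈cl⇔∈ : ∀ {p A} → p ∈cl[ F ] A ⇔ p ∈ c A
  ∈cl⇔∈ {A = A} = mk⇔
    (λ p∈clA → p∈clA (c A) (closed A) (extensive A))
    (λ p∈cA C FC A⊆C → least FC (λ {x} → A⊆C {x}) p∈cA)

  sameClosure⇒≡ : ∀ {A B} → SameClosure F A B → c A ≡ c B
  sameClosure⇒≡ same = ⊆-antisym
    (λ p∈cA → to ∈cl⇔∈ (to (same _) (from ∈cl⇔∈ p∈cA)))
    (λ p∈cB → to ∈cl⇔∈ (from (same _) (from ∈cl⇔∈ p∈cB)))

  ≡⇒sameClosure : ∀ {A B} → c A ≡ c B → SameClosure F A B
  ≡⇒sameClosure cA≡cB p = mk⇔
    (λ p∈clA → from ∈cl⇔∈ (subst (p ∈_) cA≡cB (to ∈cl⇔∈ p∈clA)))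
    (λ p∈clB → from ∈cl⇔∈ (subst (p ∈_) (sym cA≡cB) (to ∈cl⇔∈ p∈clB)))

  closure-invariant⇒continuous : ∀ {f} → (∀ A → f (c A) ≡ f A) → Continuous F f
  closure-invariant⇒continuous {f} invariant A B same =
    ≡⇒sameClosure (cong c fA≡fB)
    where
    fA≡fB : f A ≡ f B
    fA≡fB = trans (sym (invariant A)) (trans (cong f (sameClosure⇒≡ same)) (invariant B))

module Implication {n} (S : Subset n) (p : Fin n) where

  ImplicationClosed : Family n
  ImplicationClosed X = S ⊆ X → p ∈ X

  implicationClosed-closedUnderIntersections : ClosedUnderIntersections ImplicationClosed
  implicationClosed-closedUnderIntersections I A C closedA C≡⋂A S⊆C =
    from (C≡⋂A p) (λ i → closedA i (λ q∈S → to (C≡⋂A _) (S⊆C q∈S) i))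

  implicationClosure : Subset n → Subset n
  implicationClosure A with S ⊆? A
  ... | yes _ = ⁅ p ⁆ ∪ A
  ... | no _  = A

  implicationClosure-isClosureOperator :
    IsClosureOperatorOf ImplicationClosed implicationClosure
  implicationClosure-isClosureOperator = record
    { closed = closed ; extensive = extensive ; least = least }
    where
    closed : ∀ A → ImplicationClosed (implicationClosure A)
    closed A with S ⊆? A
    ... | yes _   = λ _ → x∈p∪q⁺ (inj₁ (x∈⁅x⁆ p))
    ... | no S⊈A = λ S⊆A → ⊥-elim (S⊈A S⊆A)

    extensive : ∀ A → A ⊆ implicationClosure A
    extensive A with S ⊆? A
    ... | yes _ = λ x∈A → x∈p∪q⁺ (inj₂ x∈A)
    ... | no _  = id

    least : ∀ {A C} → ImplicationClosed C → A ⊆ C → implicationClosure A ⊆ C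
    least {A} {C} closedC A⊆C with S ⊆? A
    ... | no _    = A⊆C
    ... | yes S⊆A = λ x∈ → inC (x∈p∪q⁻ ⁅ p ⁆ A x∈)
      where
      inC : ∀ {x} → x ∈ ⁅ p ⁆ ⊎ x ∈ A → x ∈ C
      inC (inj₁ x∈⁅p⁆) = subst (_∈ C) (sym (x∈⁅y⁆⇒x≡y p x∈⁅p⁆)) (closedC (λ q∈S → A⊆C (S⊆A q∈S)))
      inC (inj₂ x∈A)   = A⊆C x∈A

T-does⇔ : ∀ {a} {P : Set a} (P? : Dec P) → T (does P?) ⇔ P
T-does⇔ (yes p)  = mk⇔ (λ _ → p) _
T-does⇔ (no ¬p) = mk⇔ (λ ()) ¬p

∈-tabulate : ∀ {n} {b : Fin n → Bool} {q} → q ∈ tabulate b ⇔ T (b q)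
∈-tabulate {b = b} {q} = mk⇔
  (λ q∈ → from T-≡ (trans (sym (lookup∘tabulate b q)) ([]=⇒lookup q∈)))
  (λ Tbq → lookup⇒[]= q _ (trans (lookup∘tabulate b q) (to T-≡ Tbq)))

-- inverseMap f is hits (λ p → f ⁅ p ⁆).
hits : ∀ {n} → (Fin n → Subset n) → Subset n → Subset n
hits N A = tabulate (λ q → does (nonempty? (A ∩ N q)))

∈-hits : ∀ {n} {N : Fin n → Subset n} {A q} → q ∈ hits N A ⇔ Nonempty (A ∩ N q)
∈-hits = mk⇔
  (λ q∈ → to (T-does⇔ (nonempty? _)) (to ∈-tabulate q∈))
  (λ meets → from ∈-tabulate (from (T-does⇔ (nonempty? _)) meets))

union-meets⇔ : ∀ {n} {I : Set} {A : I → Subset n} {C B : Subset n} →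
               IsUnion A C → Nonempty (C ∩ B) ⇔ ∃ (λ i → Nonempty (A i ∩ B))
union-meets⇔ {A = A} {C} {B} C≡⋃A = mk⇔
  (λ (p , p∈C∩B) → let (p∈C , p∈B) = x∈p∩q⁻ C B p∈C∩B
                       (i , p∈Ai)  = to (C≡⋃A p) p∈C
                   in i , p , x∈p∩q⁺ (p∈Ai , p∈B))
  (λ (i , p , p∈Ai∩B) → let (p∈Ai , p∈B) = x∈p∩q⁻ (A i) B p∈Ai∩B
                        in p , x∈p∩q⁺ (from (C≡⋃A p) (i , p∈Ai) , p∈B))

hits-unionPreserving : ∀ {n} (N : Fin n → Subset n) → UnionPreserving (hits N)
hits-unionPreserving N I A C C≡⋃A q = mk⇔
  (λ q∈ → let (i , meets) = to (union-meets⇔ C≡⋃A) (to ∈-hits q∈) in i , from ∈-hits meets)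
  (λ (i , q∈) → from ∈-hits (from (union-meets⇔ C≡⋃A) (i , to ∈-hits q∈)))

pair : Subset 3
pair = outside ∷ inside ∷ inside ∷ []

open Implication pair zero
open ClosureOperator implicationClosure-isClosureOperator

towardsZero : Fin 3 → Subset 3
towardsZero zero = pair
towardsZero _    = ⊥

f : Subset 3 → Subset 3
f = hits towardsZero

f-closureInvariant : ∀ A → f (implicationClosure A) ≡ f A
f-closureInvariant (outside ∷ outside ∷ outside ∷ []) = refl
f-closureInvariant (outside ∷ outside ∷ inside  ∷ []) = refl
f-closureInvariant (outside ∷ inside  ∷ outside ∷ []) = refl
f-closureInvariant (outside ∷ inside  ∷ inside  ∷ []) = refl
f-closureInvariant (inside  ∷ outside ∷ outside ∷ []) = refl
f-closureInvariant (inside  ∷ outside ∷ inside  ∷ []) = refl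
f-closureInvariant (inside  ∷ inside  ∷ outside ∷ []) = refl
f-closureInvariant (inside  ∷ inside  ∷ inside  ∷ []) = refl

implicationClosed-isClosureFamily : IsClosureFamily ImplicationClosed
implicationClosed-isClosureFamily = fixed⇒closed refl , fixed⇒closed refl , singletonClosed
                , implicationClosed-closedUnderIntersections
  where
  singletonClosed : ∀ p → ImplicationClosed ⁅ p ⁆
  singletonClosed zero             = fixed⇒closed refl
  singletonClosed (suc zero)       = fixed⇒closed refl
  singletonClosed (suc (suc zero)) = fixed⇒closed refl

inverse-discontinuous : ¬ Continuous ImplicationClosed (inverseMap f)
inverse-discontinuous continuous = ∉⊥ (to ∈cl⇔∈ 0∈cl[g-pair])
  where
  0∈cl[g-pair] : zero ∈cl[ ImplicationClosed ] inverseMap f pair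
  0∈cl[g-pair] = from (continuous pair ⊤ (≡⇒sameClosure refl) zero) (from ∈cl⇔∈ ∈⊤)

mainTheorem1 : Σ ℕ (λ n → Σ (Family n) (λ F → Σ (Subset n → Subset n) (λ f →
    IsClosureFamily F × UnionPreserving f × Continuous F f
    × ¬ Continuous F (inverseMap f))))
mainTheorem1 =
  3 , ImplicationClosed , f
  , implicationClosed-isClosureFamily
  , hits-unionPreserving towardsZero
  , closure-invariant⇒continuous f-closureInvariant
  , inverse-discontinuous
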